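{- Let $n\geq1$ and let $P_n$ be the (undirected) path on $n$ vertices. Then $dom^+_{maj}(P_n)=-n+2\lceil\frac{n+2}{4}\rceil$, and $DOM^+_{maj}(P_n)=0$ if $n$ is even and $DOM^+_{maj}(P_n)=1$ if $n$ is odd.
   Context: Digraphs are finite, without loops or multiple arcs. For a digraph $D=(V,A)$ and $u\in V$, $N^+[u]=\{u\}\cup\{v: uv\in A\}$; for $f:V\to\{ -1,1\}$ and $X\subseteq V$, $f(X)=\sum_{v\in X}f(v)$. A majority out-dominating function (MODF) of $D$ is $f:V\to\{ -1,1\}$ with $|\{v: f(N^+[v])\geq1\}|\geq|V|/2$; its weight is $f(V)$; $\gamma^+_{maj}(D)$ is the minimum weight of a MODF. An orientation of a graph $G=(V,E)$ is a digraph $(V,A)$ obtained by replacing each edge $uv$ by exactly one of the arcs $uv$, $vu$. $dom^+_{maj}(G)$ and $DOM^+_{maj}(G)$ are the minimum and maximum of $\gamma^+_{maj}(D)$ over all orientations $D$ of $G$. -}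

module Defs where

open import Data.Bool using (Bool; true; false; if_then_else_; _∨_; _xor_)
open import Data.Nat using (ℕ; zero; suc; _≡ᵇ_) renaming (_+_ to _+ℕ_; _*_ to _*ℕ_; _≤_ to _≤ℕ_)
open import Data.Nat.DivMod using (_/_)
open import Data.Fin using (Fin; toℕ) renaming (zero to fz; suc to fs)
open import Data.Integer using (ℤ; +_; -[1+_]; _+_; _≤_)
open import Relation.Binary.PropositionalEquality using (_≡_)
open import Relation.Nullary.Decidable using (⌊_⌋)
open import Data.Product using (_×_; Σ; ∃-syntax)

Graph : ℕ → Set
Graph n = Fin n → Fin n → Bool

Digraph : ℕ → Set
Digraph n = Fin n → Fin n → Bool      -- A u v ≡ true  iff  uv is an arc

PathG : (n : ℕ) → Graph n
PathG n u v = (suc (toℕ u) ≡ᵇ toℕ v) ∨ (suc (toℕ v) ≡ᵇ toℕ u)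

IsOrientation : {n : ℕ} → Graph n → Digraph n → Set
IsOrientation {n} G D =
  (u v : Fin n) → (D u v ≡ true → G u v ≡ true) × (G u v ≡ true → (D u v xor D v u) ≡ true)

data PM : Set where
  plus minus : PM

val : PM → ℤ
val plus  = + 1
val minus = -[1+ 0 ]

Σℤ : {n : ℕ} → (Fin n → ℤ) → ℤ
Σℤ {zero}  g = + 0
Σℤ {suc n} g = g fz + Σℤ (λ i → g (fs i))

count : {n : ℕ} → (Fin n → Bool) → ℕ
count {zero}  p = 0
count {suc n} p = (if p fz then 1 else 0) +ℕ count (λ i → p (fs i))

closedOutSum : {n : ℕ} → Digraph n → (Fin n → PM) → Fin n → ℤ
closedOutSum D f u = val (f u) + Σℤ (λ v → if D u v then val (f v) else + 0)

weight : {n : ℕ} → (Fin n → PM) → ℤ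
weight f = Σℤ (λ v → val (f v))

-- f is a majority out-dominating function: |{v : f(N⁺[v]) ≥ 1}| ≥ n/2,
-- i.e. 2·|{…}| ≥ n.
IsMODF : {n : ℕ} → Digraph n → (Fin n → PM) → Set
IsMODF {n} D f = n ≤ℕ 2 *ℕ count (λ v → ⌊ + 1 Data.Integer.≤? closedOutSum D f v ⌋)

IsGammaMaj : {n : ℕ} → Digraph n → ℤ → Set
IsGammaMaj D w =
  (Σ _ λ f → IsMODF D f × weight f ≡ w) × (∀ f → IsMODF D f → w ≤ weight f)

IsDomMaj : {n : ℕ} → Graph n → ℤ → Set
IsDomMaj G w =
  (Σ _ λ D → IsOrientation G D × IsGammaMaj D w)
  × (∀ D → IsOrientation G D → ∀ w' → IsGammaMaj D w' → w ≤ w')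

IsDOMMaj : {n : ℕ} → Graph n → ℤ → Set
IsDOMMaj G w =
  (Σ _ λ D → IsOrientation G D × IsGammaMaj D w)
  × (∀ D → IsOrientation G D → ∀ w' → IsGammaMaj D w' → w' ≤ w)

⌈_/4⌉ : ℕ → ℕ
⌈ m /4⌉ = (m +ℕ 3) / 4

-- In an orientation of P_n every out-neighbour of u is u − 1 or u + 1, so a vertex u with
-- f(N⁺[u]) ≥ 1 is positive, or negative with both u − 1 and u + 1 positive out-neighbours.
-- Fewer vertices are of the second kind than there are positive vertices a (i ↦ i + 1 misses
-- the first positive vertex), so n/2 ≤ 2a − 1 and a ≥ ⌈(n + 2)/4⌉; orienting every edge away
-- from its odd endpoint and making the first ⌈(n + 2)/4⌉ even vertices positive attains this.
-- In the directed path every good vertex is positive, so its γ⁺ is 2⌈n/2⌉ − n, i.e. the parity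
-- of n. No orientation does worse: some half of the path receives no arc from its complement
-- (decided by the arcs at the middle vertex) and can be made positive, except when the middle
-- vertex m of P_{2m+1} is a source; then [0, m) ∪ {m + 1} is made positive.

module Submission where

open import Defs
open import Data.Nat using (ℕ; _≥_; _+_; _%_)
open import Data.Integer using (ℤ; +_; -_; _-_) renaming (_+_ to _+ℤ_; _*_ to _*ℤ_)
open import Data.Product using (_×_)
open import Relation.Binary.PropositionalEquality using (_≡_)

open import Algebra.Properties.CommutativeSemigroup using (interchange)
open import Data.Bool using (Bool; true; false; T; not; _∧_; _∨_; _xor_; if_then_else_)
open import Data.Bool.Properties using (T-∧; T-∨; T-≡; ∨-comm; ∧-identityʳ; not-involutive; xor-inverseʳ)
open import Data.Empty using (⊥-elim)
open import Data.Fin using (Fin; toℕ; fromℕ<) renaming (zero to fz; suc to fs)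
open import Data.Fin.Properties using (toℕ-injective; toℕ-fromℕ<; toℕ<n)
open import Data.Integer using (-[1+_]; _⊖_; +≤+; -≤+) renaming (_≤_ to _≤ℤ_)
import Data.Integer.Properties as ℤₚ
open import Data.Nat using (zero; suc; pred; _∸_; _*_; _≤_; _<_; _<?_; _<ᵇ_; _≡ᵇ_; z≤n; s≤s)
open import Data.Nat.Properties
open import Data.Nat.Tactic.RingSolver using (solve-∀)
open import Data.Nat.DivMod using (_/_; m/n*n≤m; m≡m%n+[m/n]*n; m%n<n; m<n*o⇒m/o<n)
open import Data.Product using (Σ; _,_; proj₁; proj₂)
open import Data.Sum using (_⊎_; inj₁; inj₂)
open import Function using (_∘_)
open import Function.Bundles using (Equivalence)
open import Relation.Binary.PropositionalEquality
  using (_≢_; refl; sym; trans; cong; cong₂; subst; subst₂; module ≡-Reasoning)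
open import Relation.Nullary using (¬_; Dec; contradiction; yes; no)
open import Relation.Nullary.Decidable using (toWitness; fromWitness; T?)

Σℤ-cong : ∀ {n} {g h : Fin n → ℤ} → (∀ v → g v ≡ h v) → Σℤ g ≡ Σℤ h
Σℤ-cong {zero}  e = refl
Σℤ-cong {suc n} e = cong₂ _+ℤ_ (e fz) (Σℤ-cong (e ∘ fs))

Σℤ-mono : ∀ {n} {g h : Fin n → ℤ} → (∀ v → g v ≤ℤ h v) → Σℤ g ≤ℤ Σℤ h
Σℤ-mono {zero}  le = ℤₚ.≤-refl
Σℤ-mono {suc n} le = ℤₚ.+-mono-≤ (le fz) (Σℤ-mono (le ∘ fs))

Σℤ-zero : ∀ n → Σℤ {n} (λ _ → + 0) ≡ + 0
Σℤ-zero zero    = refl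
Σℤ-zero (suc n) = cong (+ 0 +ℤ_) (Σℤ-zero n)

Σℤ-nonneg : ∀ {n} {g : Fin n → ℤ} → (∀ v → + 0 ≤ℤ g v) → + 0 ≤ℤ Σℤ g
Σℤ-nonneg {n} {g} le = subst (_≤ℤ Σℤ g) (Σℤ-zero n) (Σℤ-mono le)

Σℤ-+ : ∀ {n} (g h : Fin n → ℤ) → Σℤ (λ v → g v +ℤ h v) ≡ Σℤ g +ℤ Σℤ h
Σℤ-+ {zero}  g h = refl
Σℤ-+ {suc n} g h = trans (cong (g fz +ℤ h fz +ℤ_) (Σℤ-+ (g ∘ fs) (h ∘ fs)))
                         (interchange ℤₚ.+-commutativeSemigroup (g fz) (h fz) _ _)

indicator : Bool → ℕ
indicator b = if b then 1 else 0

count-cong : ∀ {n} {p q : Fin n → Bool} → (∀ v → p v ≡ q v) → count p ≡ count q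
count-cong {zero}  e = refl
count-cong {suc n} e = cong₂ _+_ (cong indicator (e fz)) (count-cong (e ∘ fs))

count-mono : ∀ {n} {p q : Fin n → Bool} → (∀ v → T (p v) → T (q v)) → count p ≤ count q
count-mono {zero}  imp = z≤n
count-mono {suc n} {p} {q} imp = +-mono-≤ (head (p fz) (q fz) (imp fz)) (count-mono (imp ∘ fs))
  where
  head : ∀ a b → (T a → T b) → indicator a ≤ indicator b
  head false b   _ = z≤n
  head true  true _ = ≤-refl
  head true false i = ⊥-elim (i _)

count-∨ : ∀ {n} (p q : Fin n → Bool) → count (λ v → p v ∨ q v) ≤ count p + count q
count-∨ {zero}  p q = z≤n
count-∨ {suc n} p q = ≤-trans (+-mono-≤ (head (p fz) (q fz)) (count-∨ (p ∘ fs) (q ∘ fs)))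
  (≤-reflexive (interchange +-commutativeSemigroup
    (indicator (p fz)) (indicator (q fz)) (count (p ∘ fs)) (count (q ∘ fs))))
  where
  head : ∀ a b → indicator (a ∨ b) ≤ indicator a + indicator b
  head false b     = ≤-refl
  head true  false = ≤-refl
  head true  true  = s≤s z≤n

count-false : ∀ n → count {n} (λ _ → false) ≡ 0
count-false zero    = refl
count-false (suc n) = count-false n

count-suc-beyond : ∀ n (A : ℕ → Bool) → A n ≡ false → count {suc n} (A ∘ toℕ) ≡ count {n} (A ∘ toℕ)
count-suc-beyond zero    A An rewrite An = refl
count-suc-beyond (suc n) A An = cong₂ _+_ refl (count-suc-beyond n (A ∘ suc) An)

-- The map i ↦ i + 2 injects the counted positions into the positives other than the first one.
count-∧-shift2 : ∀ n (A : ℕ → Bool) →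
  count {n} (λ v → A (toℕ v) ∧ A (2 + toℕ v)) ≤ pred (count {2 + n} (A ∘ toℕ))
count-∧-shift2 zero    A = z≤n
count-∧-shift2 (suc n) A with A 0 | A 2 | count-∧-shift2 n (A ∘ suc)
... | false | _     | ih = ih
... | true  | false | ih = ≤-trans ih pred[n]≤n
... | true  | true  | ih =
  ≤-trans (s≤s ih) (≤-reflexive (trans (cong (suc ∘ pred) (+-suc x y)) (sym (+-suc x y))))
  where
  x y : ℕ
  x = indicator (A 1)
  y = count {n} (λ v → A (3 + toℕ v))

bothNeighbours : (ℕ → Bool) → ℕ → Bool
bothNeighbours A zero    = false
bothNeighbours A (suc j) = A j ∧ A (2 + j)

count-bothNeighbours : ∀ n (A : ℕ → Bool) → A n ≡ false →
  count {n} (bothNeighbours A ∘ toℕ) ≤ pred (count {n} (A ∘ toℕ))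
count-bothNeighbours zero    A An = z≤n
count-bothNeighbours (suc n) A An =
  subst (λ k → count {n} (λ v → A (toℕ v) ∧ A (2 + toℕ v)) ≤ pred k)
        (count-suc-beyond (suc n) A An) (count-∧-shift2 n A)

-- i ∈ [l, r), written with _<ᵇ_ only so that it reduces when all three arguments are successors.
inInterval : ℕ → ℕ → ℕ → Bool
inInterval l r i = (i <ᵇ r) ∧ not (i <ᵇ l)

T-not⁺ : ∀ {b} → ¬ T b → T (not b)
T-not⁺ {false} _  = _
T-not⁺ {true}  ¬t = ¬t _

T-not⁻ : ∀ {b} → T (not b) → ¬ T b
T-not⁻ {false} _ ()

inInterval⁺ : ∀ {l r i} → l ≤ i → i < r → T (inInterval l r i)
inInterval⁺ {l} {r} {i} l≤i i<r =
  Equivalence.from T-∧ (<⇒<ᵇ i<r , T-not⁺ λ i<ᵇl → <⇒≱ (<ᵇ⇒< i l i<ᵇl) l≤i)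

inInterval⁻ : ∀ {l r i} → T (inInterval l r i) → l ≤ i × i < r
inInterval⁻ {l} {r} {i} inside with Equivalence.to T-∧ inside
... | i<ᵇr , i≮ᵇl = ≮⇒≥ (T-not⁻ i≮ᵇl ∘ <⇒<ᵇ) , <ᵇ⇒< i r i<ᵇr

count-inInterval : ∀ {n} l r → r ≤ n → count {n} (λ v → inInterval l r (toℕ v)) ≡ r ∸ l
count-inInterval {n}     l       zero    _         = trans (count-false n) (sym (0∸n≡0 l))
count-inInterval {suc n} zero    (suc r) (s≤s r≤n) = cong suc (count-inInterval zero r r≤n)
count-inInterval {suc n} (suc l) (suc r) (s≤s r≤n) = count-inInterval l r r≤n

count-<ᵇ-∧ : ∀ {n} p (P : ℕ → Bool) →
  count {n} (λ v → (toℕ v <ᵇ p) ∧ P (toℕ v)) ≤ count {p} (P ∘ toℕ)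
count-<ᵇ-∧ {n}     zero    P = ≤-reflexive (count-false n)
count-<ᵇ-∧ {zero}  (suc p) P = z≤n
count-<ᵇ-∧ {suc n} (suc p) P = +-monoʳ-≤ (indicator (P 0)) (count-<ᵇ-∧ {n} p (P ∘ suc))

mutual
  even : ℕ → Bool
  even zero    = true
  even (suc n) = odd n

  odd : ℕ → Bool
  odd zero    = false
  odd (suc n) = even n

even≡not-odd : ∀ n → even n ≡ not (odd n)
even≡not-odd zero          = refl
even≡not-odd (suc zero)    = refl
even≡not-odd (suc (suc n)) = even≡not-odd n

count-odd : ∀ m → count {m + m} (odd ∘ toℕ) ≡ m
count-odd zero    = refl
count-odd (suc m) rewrite +-suc m m = cong suc (count-odd m)

odd⇒suc : ∀ i → odd i ≡ true → i ≡ suc (pred i)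
odd⇒suc (suc i) _ = refl

even-double : ∀ m → even (m + m) ≡ true
even-double zero    = refl
even-double (suc m) rewrite +-suc m m = even-double m

extend : {A : Set} {n : ℕ} → A → (Fin n → A) → ℕ → A
extend {n = zero}  d f _       = d
extend {n = suc n} d f zero    = f fz
extend {n = suc n} d f (suc m) = extend d (f ∘ fs) m

extend-toℕ : ∀ {A : Set} {n} (d : A) (f : Fin n → A) v → extend d f (toℕ v) ≡ f v
extend-toℕ d f fz     = refl
extend-toℕ d f (fs v) = extend-toℕ d (f ∘ fs) v

extend-beyond : ∀ {A : Set} {n} (d : A) (f : Fin n → A) {m} → n ≤ m → extend d f m ≡ d
extend-beyond {n = zero}  d f _         = refl
extend-beyond {n = suc n} d f (s≤s n≤m) = extend-beyond d (f ∘ fs) n≤m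

isPlus : PM → Bool
isPlus plus  = true
isPlus minus = false

isPlus-if : ∀ b → isPlus (if b then plus else minus) ≡ b
isPlus-if true  = refl
isPlus-if false = refl

if-plus : ∀ {b} → T b → (if b then plus else minus) ≡ plus
if-plus {true} _ = refl

plusCount : ∀ {n} → (Fin n → PM) → ℕ
plusCount f = count (isPlus ∘ f)

weight≡2*plusCount⊖n : ∀ {n} (f : Fin n → PM) → weight f ≡ (2 * plusCount f) ⊖ n
weight≡2*plusCount⊖n {zero}  f = refl
weight≡2*plusCount⊖n {suc n} f with f fz | weight≡2*plusCount⊖n (f ∘ fs)
... | plus  | ih = begin
  + 1 +ℤ weight (f ∘ fs)             ≡⟨ cong (+ 1 +ℤ_) ih ⟩
  + 1 +ℤ (2 * a ⊖ n)                 ≡⟨ ℤₚ.distribʳ-⊖-+-pos 1 (2 * a) n ⟩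
  suc (2 * a) ⊖ n                    ≡⟨ ℤₚ.[1+m]⊖[1+n]≡m⊖n (suc (2 * a)) n ⟨
  suc (suc (2 * a)) ⊖ suc n          ≡⟨ cong (_⊖ suc n) (*-suc 2 a) ⟨
  2 * suc a ⊖ suc n                  ∎
  where
  open ≡-Reasoning
  a = plusCount (f ∘ fs)
... | minus | ih = trans (cong (-[1+ 0 ] +ℤ_) ih) (ℤₚ.distribʳ-⊖-+-neg 0 _ n)

weight≤ : ∀ {n} (f : Fin n → PM) {k} → plusCount f ≤ k → weight f ≤ℤ (2 * k) ⊖ n
weight≤ {n} f a≤k = subst (_≤ℤ _) (sym (weight≡2*plusCount⊖n f))
                            (ℤₚ.⊖-monoˡ-≤ n (*-monoʳ-≤ 2 a≤k))

weight≥ : ∀ {n} (f : Fin n → PM) {k} → k ≤ plusCount f → (2 * k) ⊖ n ≤ℤ weight f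
weight≥ {n} f k≤a = subst (_ ≤ℤ_) (sym (weight≡2*plusCount⊖n f))
                            (ℤₚ.⊖-monoˡ-≤ n (*-monoʳ-≤ 2 k≤a))

Σℤ-at : ∀ n k (h : ℕ → ℤ) →
  Σℤ {n} (λ v → if toℕ v ≡ᵇ k then h (toℕ v) else + 0) ≡ (if k <ᵇ n then h k else + 0)
Σℤ-at zero    k       h = refl
Σℤ-at (suc n) zero    h = trans (cong (h 0 +ℤ_) (Σℤ-zero n)) (ℤₚ.+-identityʳ (h 0))
Σℤ-at (suc n) (suc k) h = trans (ℤₚ.+-identityˡ _) (Σℤ-at n k (h ∘ suc))

≡ᵇ-sym : ∀ m n → (m ≡ᵇ n) ≡ (n ≡ᵇ m)
≡ᵇ-sym zero    zero    = refl
≡ᵇ-sym zero    (suc n) = refl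
≡ᵇ-sym (suc m) zero    = refl
≡ᵇ-sym (suc m) (suc n) = ≡ᵇ-sym m n

Σℤ-successor : ∀ n i (h : ℕ → ℤ) →
  Σℤ {n} (λ v → if suc i ≡ᵇ toℕ v then h (toℕ v) else + 0) ≡ (if suc i <ᵇ n then h (suc i) else + 0)
Σℤ-successor n i h =
  trans (Σℤ-cong {n} (λ v → cong (λ b → if b then h (toℕ v) else + 0) (≡ᵇ-sym (suc i) (toℕ v))))
        (Σℤ-at n (suc i) h)

pathEdges-disjoint : ∀ i j → ((suc i ≡ᵇ j) ∧ (suc j ≡ᵇ i)) ≡ false
pathEdges-disjoint zero    zero          = refl
pathEdges-disjoint zero    (suc zero)    = refl
pathEdges-disjoint zero    (suc (suc j)) = refl
pathEdges-disjoint (suc i) zero          = refl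
pathEdges-disjoint (suc i) (suc j)       = pathEdges-disjoint i j

Σℤ-path : ∀ {n} (h : ℕ → ℤ) (u : Fin n) →
  Σℤ (λ v → if PathG n u v then h (toℕ v) else + 0)
    ≡ Σℤ {n} (λ v → if suc (toℕ u) ≡ᵇ toℕ v then h (toℕ v) else + 0)
      +ℤ Σℤ {n} (λ v → if suc (toℕ v) ≡ᵇ toℕ u then h (toℕ v) else + 0)
Σℤ-path {n} h u =
  trans (Σℤ-cong {n} λ v → split (up v) (down v) (h (toℕ v)) (pathEdges-disjoint (toℕ u) (toℕ v)))
        (Σℤ-+ {n} (λ v → if up v then h (toℕ v) else + 0) (λ v → if down v then h (toℕ v) else + 0))
  where
  up down : Fin n → Bool
  up   v = suc (toℕ u) ≡ᵇ toℕ v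
  down v = suc (toℕ v) ≡ᵇ toℕ u
  split : ∀ a b x → (a ∧ b) ≡ false →
    (if a ∨ b then x else + 0) ≡ (if a then x else + 0) +ℤ (if b then x else + 0)
  split false false x _ = refl
  split false true  x _ = sym (ℤₚ.+-identityˡ x)
  split true  false x _ = sym (ℤₚ.+-identityʳ x)

if-≤ : ∀ b {x} → + 0 ≤ℤ x → (if b then x else + 0) ≤ℤ x
if-≤ true  _   = ℤₚ.≤-refl
if-≤ false 0≤x = 0≤x

if-<ᵇ : ∀ {A : Set} {m n} (x y : A) → m < n → (if m <ᵇ n then x else y) ≡ x
if-<ᵇ {m = m} {n} x y m<n rewrite Equivalence.to T-≡ (<⇒<ᵇ {m} {n} m<n) = refl

Σℤ-path-≤ : ∀ {n} (h : ℕ → ℤ) (u : Fin n) → (∀ k → + 0 ≤ℤ h k) →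
  Σℤ (λ v → if PathG n u v then h (toℕ v) else + 0) ≤ℤ h (suc (toℕ u)) +ℤ h (pred (toℕ u))
Σℤ-path-≤ {n} h u 0≤h rewrite Σℤ-path h u | Σℤ-successor n (toℕ u) h =
  ℤₚ.+-mono-≤ (if-≤ (suc (toℕ u) <ᵇ n) (0≤h _)) (predecessor (toℕ u))
  where
  predecessor : ∀ i → Σℤ {n} (λ v → if suc (toℕ v) ≡ᵇ i then h (toℕ v) else + 0) ≤ℤ h (pred i)
  predecessor zero    = subst (_≤ℤ h 0) (sym (Σℤ-zero n)) (0≤h 0)
  predecessor (suc j) = subst (_≤ℤ h j) (sym (Σℤ-at n j h)) (if-≤ (j <ᵇ n) (0≤h j))

Σℤ-path-≡ : ∀ {n} (h : ℕ → ℤ) (u : Fin n) {j} → toℕ u ≡ suc j → suc (toℕ u) < n →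
  Σℤ (λ v → if PathG n u v then h (toℕ v) else + 0) ≡ h (suc (toℕ u)) +ℤ h j
Σℤ-path-≡ {n} h u {j} u≡1+j 1+u<n rewrite Σℤ-path h u | Σℤ-successor n (toℕ u) h | u≡1+j =
  cong₂ _+ℤ_ (if-<ᵇ _ _ 1+u<n) (trans (Σℤ-at n j h) (if-<ᵇ _ _ j<n))
  where
  j<n : j < n
  j<n = <-trans (n<1+n j) (<-trans (n<1+n (suc j)) 1+u<n)

IsGood : ∀ {n} → Digraph n → (Fin n → PM) → Fin n → Set
IsGood D f u = + 1 ≤ℤ closedOutSum D f u

closedOutSum-cong : ∀ {n} (D : Digraph n) {f g : Fin n → PM} → (∀ v → f v ≡ g v) → ∀ u →
  closedOutSum D f u ≡ closedOutSum D g u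
closedOutSum-cong D f≗g u =
  cong₂ _+ℤ_ (cong val (f≗g u)) (Σℤ-cong (λ v → cong (λ x → if D u v then val x else + 0) (f≗g v)))

modf-of-good : ∀ {n} (D : Digraph n) f (P : Fin n → Bool) →
  (∀ u → T (P u) → IsGood D f u) → n ≤ 2 * count P → IsMODF D f
modf-of-good D f P good n≤ = ≤-trans n≤ (*-monoʳ-≤ 2 (count-mono λ u p → fromWitness (good u p)))

modf⇒count : ∀ {n} (D : Digraph n) f (P : Fin n → Bool) →
  (∀ u → IsGood D f u → T (P u)) → IsMODF D f → n ≤ 2 * count P
modf⇒count D f P good modf = ≤-trans modf (*-monoʳ-≤ 2 (count-mono λ u g → good u (toWitness g)))

good-of-closed : ∀ {n} (D : Digraph n) (f : Fin n → PM) u →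
  f u ≡ plus → (∀ v → T (D u v) → f v ≡ plus) → IsGood D f u
good-of-closed D f u fu out rewrite fu = ℤₚ.+-monoʳ-≤ (+ 1) (Σℤ-nonneg nonneg)
  where
  nonneg : ∀ v → + 0 ≤ℤ (if D u v then val (f v) else + 0)
  nonneg v with D u v in arc
  ... | false = ℤₚ.≤-refl
  ... | true rewrite out v (Equivalence.from T-≡ arc) = +≤+ z≤n

OnPath : ∀ {n} → Digraph n → Set
OnPath {n} D = ∀ u v → T (D u v) → T (PathG n u v)

orientation⇒onPath : ∀ {n} {D : Digraph n} → IsOrientation (PathG n) D → OnPath D
orientation⇒onPath or u v arc = Equivalence.from T-≡ (proj₁ (or u v) (Equivalence.to T-≡ arc))

pathNeighbour : ∀ {n} (u v : Fin n) → T (PathG n u v) → toℕ v ≡ suc (toℕ u) ⊎ suc (toℕ v) ≡ toℕ u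
pathNeighbour u v edge with Equivalence.to T-∨ edge
... | inj₁ up   = inj₁ (sym (≡ᵇ⇒≡ (suc (toℕ u)) (toℕ v) up))
... | inj₂ down = inj₂ (≡ᵇ⇒≡ (suc (toℕ v)) (toℕ u) down)

path-edge : ∀ {n} {x y : Fin n} → toℕ y ≡ suc (toℕ x) → T (PathG n x y) × T (PathG n y x)
path-edge {x = x} {y} y≡1+x =
  Equivalence.from T-∨ (inj₁ up) , Equivalence.from (T-∨ {suc (toℕ y) ≡ᵇ toℕ x}) (inj₂ up)
  where up = ≡⇒≡ᵇ (suc (toℕ x)) (toℕ y) (sym y≡1+x)

orientation-antisym : ∀ {n} {G : Graph n} {D : Digraph n} → IsOrientation G D →
  ∀ {x y} → T (G x y) → T (D x y) → ¬ T (D y x)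
orientation-antisym {D = D} or {x} {y} edge arc back
  with D x y | D y x | proj₂ (or x y) (Equivalence.to T-≡ edge)
... | true | true | ()

val⁺ : PM → ℤ
val⁺ plus  = + 1
val⁺ minus = + 0

good⇒plus-or-flanked : ∀ {n} (D : Digraph n) → OnPath D → (F : ℕ → PM) (u : Fin n) →
  IsGood D (F ∘ toℕ) u → T (isPlus (F (toℕ u)) ∨ bothNeighbours (isPlus ∘ F) (toℕ u))
good⇒plus-or-flanked {n} D onPath F u good =
  conclude (toℕ u) (flanked (F (toℕ u)) (F (suc (toℕ u))) (F (pred (toℕ u))) (ℤₚ.≤-trans good bound))
  where
  term : ∀ v → (if D u v then val (F (toℕ v)) else + 0)
            ≤ℤ (if PathG n u v then val⁺ (F (toℕ v)) else + 0)
  term v with D u v in arc | PathG n u v in edge | F (toℕ v)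
  ... | false | false | _     = ℤₚ.≤-refl
  ... | false | true  | plus  = +≤+ z≤n
  ... | false | true  | minus = ℤₚ.≤-refl
  ... | true  | true  | plus  = ℤₚ.≤-refl
  ... | true  | true  | minus = -≤+
  ... | true  | false | _     = ⊥-elim (subst T edge (onPath u v (Equivalence.from T-≡ arc)))
  val⁺≥0 : ∀ x → + 0 ≤ℤ val⁺ x
  val⁺≥0 plus  = +≤+ z≤n
  val⁺≥0 minus = ℤₚ.≤-refl
  bound : closedOutSum D (F ∘ toℕ) u
          ≤ℤ val (F (toℕ u)) +ℤ (val⁺ (F (suc (toℕ u))) +ℤ val⁺ (F (pred (toℕ u))))
  bound = ℤₚ.+-monoʳ-≤ (val (F (toℕ u)))
            (ℤₚ.≤-trans (Σℤ-mono term) (Σℤ-path-≤ (val⁺ ∘ F) u (val⁺≥0 ∘ F)))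
  flanked : ∀ x y z → + 1 ≤ℤ val x +ℤ (val⁺ y +ℤ val⁺ z) → x ≡ plus ⊎ (y ≡ plus × z ≡ plus)
  flanked plus  _     _     _             = inj₁ refl
  flanked minus plus  plus  _             = inj₂ (refl , refl)
  flanked minus plus  minus (+≤+ ())
  flanked minus minus plus  (+≤+ ())
  flanked minus minus minus ()
  conclude : ∀ i → F i ≡ plus ⊎ (F (suc i) ≡ plus × F (pred i) ≡ plus) →
             T (isPlus (F i) ∨ bothNeighbours (isPlus ∘ F) i)
  conclude i       (inj₁ Fi)               rewrite Fi = _
  conclude zero    (inj₂ (_ , F0))         rewrite F0 = _
  conclude (suc j) (inj₂ (F2+j , Fj))    rewrite F2+j | Fj = Equivalence.from (T-∨ {isPlus (F (suc j))}) (inj₂ _)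

good-of-flanked : ∀ {n} (D : Digraph n) → OnPath D → (F : ℕ → PM) (u : Fin n) {j : ℕ} →
  toℕ u ≡ suc j → suc (toℕ u) < n → (∀ v → T (PathG n u v) → T (D u v)) →
  F j ≡ plus → F (suc (toℕ u)) ≡ plus → IsGood D (F ∘ toℕ) u
good-of-flanked {n} D onPath F u u≡1+j 1+u<n allArcs Fj F1+u =
  subst (+ 1 ≤ℤ_) (cong (val (F (toℕ u)) +ℤ_) (sym outSum)) (atLeastOne (F (toℕ u)))
  where
  open ≡-Reasoning
  sameArcs : ∀ v → D u v ≡ PathG n u v
  sameArcs v with D u v in arc | PathG n u v in edge
  ... | false | false = refl
  ... | true  | true  = refl
  ... | true  | false = ⊥-elim (subst T edge (onPath u v (Equivalence.from T-≡ arc)))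
  ... | false | true  = ⊥-elim (subst T arc (allArcs v (Equivalence.from T-≡ edge)))
  outSum : Σℤ (λ v → if D u v then val (F (toℕ v)) else + 0) ≡ + 2
  outSum = begin
    Σℤ (λ v → if D u v then val (F (toℕ v)) else + 0)
      ≡⟨ Σℤ-cong (λ v → cong (λ b → if b then val (F (toℕ v)) else + 0) (sameArcs v)) ⟩
    Σℤ (λ v → if PathG n u v then val (F (toℕ v)) else + 0)
      ≡⟨ Σℤ-path-≡ (val ∘ F) u u≡1+j 1+u<n ⟩
    val (F (suc (toℕ u))) +ℤ val (F _)
      ≡⟨ cong₂ _+ℤ_ (cong val F1+u) (cong val Fj) ⟩
    + 2 ∎
  atLeastOne : ∀ x → + 1 ≤ℤ val x +ℤ + 2
  atLeastOne plus  = +≤+ (s≤s z≤n)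
  atLeastOne minus = ℤₚ.≤-refl

-- No arc from index r − 1 to r, and no arc from l to l − 1, stated without subtraction.
NoArcUp : ∀ {n} → Digraph n → ℕ → Set
NoArcUp D r = ∀ u v → T (D u v) → suc (toℕ u) ≡ r → toℕ v ≢ r

NoArcDown : ∀ {n} → Digraph n → ℕ → Set
NoArcDown D l = ∀ u v → T (D u v) → toℕ u ≡ l → suc (toℕ v) ≢ l

good-in-interval : ∀ {n} (D : Digraph n) → OnPath D → (F : ℕ → PM) {l r : ℕ} →
  (∀ i → T (inInterval l r i) → F i ≡ plus) → NoArcUp D r → NoArcDown D l →
  ∀ u → T (inInterval l r (toℕ u)) → IsGood D (F ∘ toℕ) u
good-in-interval D onPath F {l} {r} plusInside noUp noDown u inside =
  good-of-closed D (F ∘ toℕ) u (plusInside _ inside) (λ v arc → plusInside _ (stays v arc))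
  where
  l≤u : l ≤ toℕ u
  l≤u = proj₁ (inInterval⁻ {l} {r} inside)
  u<r : toℕ u < r
  u<r = proj₂ (inInterval⁻ {l} {r} inside)
  stays : ∀ v → T (D u v) → T (inInterval l r (toℕ v))
  stays v arc with pathNeighbour u v (onPath u v arc)
  ... | inj₁ v≡1+u = inInterval⁺
    (≤-trans l≤u (subst (toℕ u ≤_) (sym v≡1+u) (n≤1+n _)))
    (≤∧≢⇒< (subst (_≤ r) (sym v≡1+u) u<r) (λ v≡r → noUp u v arc (trans (sym v≡1+u) v≡r) v≡r))
  ... | inj₂ 1+v≡u = inInterval⁺
    (≤-pred (≤∧≢⇒< (subst (l ≤_) (sym 1+v≡u) l≤u)
                    (λ l≡1+v → noDown u v arc (trans (sym 1+v≡u) (sym l≡1+v)) (sym l≡1+v))))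
    (<-trans (subst (toℕ v <_) 1+v≡u ≤-refl) u<r)

noArcUp-end : ∀ {n} (D : Digraph n) → NoArcUp D n
noArcUp-end D u v _ _ v≡n = <-irrefl v≡n (toℕ<n v)

noArcDown-start : ∀ {n} (D : Digraph n) → NoArcDown D 0
noArcDown-start D _ _ _ _ ()

noArcUp-of-absent : ∀ {n} (D : Digraph n) {x y} → ¬ T (D x y) → toℕ y ≡ suc (toℕ x) → NoArcUp D (toℕ y)
noArcUp-of-absent D {x} {y} ¬xy y≡1+x u v arc 1+u≡y v≡y
  with toℕ-injective {i = u} {x} (suc-injective (trans 1+u≡y y≡1+x)) | toℕ-injective {i = v} {y} v≡y
... | refl | refl = ¬xy arc

noArcDown-of-absent : ∀ {n} (D : Digraph n) {x y} → ¬ T (D y x) → toℕ y ≡ suc (toℕ x) → NoArcDown D (toℕ y)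
noArcDown-of-absent D {x} {y} ¬yx y≡1+x u v arc u≡y 1+v≡y
  with toℕ-injective {i = u} {y} u≡y | toℕ-injective {i = v} {x} (suc-injective (trans 1+v≡y y≡1+x))
... | refl | refl = ¬yx arc

block : ℕ → ℕ → ℕ → PM
block l r i = if inInterval l r i then plus else minus

plusCount-block : ∀ {n} l r → r ≤ n → plusCount {n} (block l r ∘ toℕ) ≡ r ∸ l
plusCount-block {n} l r r≤n =
  trans (count-cong {n} (isPlus-if ∘ inInterval l r ∘ toℕ)) (count-inInterval l r r≤n)

BoundedMODF : ∀ {n} → Digraph n → ℤ → Set
BoundedMODF {n} D w = Σ (Fin n → PM) λ f → IsMODF D f × weight f ≤ℤ w

block-boundedMODF : ∀ {n} (D : Digraph n) → OnPath D → ∀ {l r} → r ≤ n → n ≤ 2 * (r ∸ l) →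
  NoArcUp D r → NoArcDown D l → BoundedMODF D ((2 * (r ∸ l)) ⊖ n)
block-boundedMODF {n} D onPath {l} {r} r≤n n≤ noUp noDown =
  block l r ∘ toℕ ,
  modf-of-good D (block l r ∘ toℕ) (inInterval l r ∘ toℕ)
    (good-in-interval D onPath (block l r) (λ _ → if-plus) noUp noDown)
    (subst (λ k → n ≤ 2 * k) (sym (count-inInterval l r r≤n)) n≤) ,
  weight≤ {n} (block l r ∘ toℕ) (≤-reflexive (plusCount-block l r r≤n))

prefix-boundedMODF : ∀ {n} (D : Digraph n) → OnPath D → ∀ {x y} → ¬ T (D x y) → toℕ y ≡ suc (toℕ x) →
  n ≤ 2 * toℕ y → BoundedMODF D ((2 * toℕ y) ⊖ n)
prefix-boundedMODF D onPath {x} {y} ¬xy y≡1+x n≤ =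
  block-boundedMODF D onPath (<⇒≤ (toℕ<n y)) n≤ (noArcUp-of-absent D {x} {y} ¬xy y≡1+x) (noArcDown-start D)

suffix-boundedMODF : ∀ {n} (D : Digraph n) → OnPath D → ∀ {x y} → ¬ T (D y x) → toℕ y ≡ suc (toℕ x) →
  n ≤ 2 * (n ∸ toℕ y) → BoundedMODF D ((2 * (n ∸ toℕ y)) ⊖ n)
suffix-boundedMODF D onPath {x} {y} ¬yx y≡1+x n≤ =
  block-boundedMODF D onPath ≤-refl n≤ (noArcUp-end D) (noArcDown-of-absent D {x} {y} ¬yx y≡1+x)

isGammaMaj-intro : ∀ {n} {D : Digraph n} {w} → BoundedMODF D w → (∀ f → IsMODF D f → w ≤ℤ weight f) →
  IsGammaMaj D w
isGammaMaj-intro (f , modf , f≤w) lower = (f , modf , ℤₚ.≤-antisym f≤w (lower f modf)) , lower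

isDomMaj-intro : ∀ {n} {G : Graph n} {w} D → IsOrientation G D → BoundedMODF D w →
  (∀ D → IsOrientation G D → ∀ f → IsMODF D f → w ≤ℤ weight f) → IsDomMaj G w
isDomMaj-intro D orD bounded lower =
  (D , orD , isGammaMaj-intro bounded (lower D orD)) ,
  λ D′ orD′ w′ ((f′ , modf′ , f′≡w′) , _) → subst (_ ≤ℤ_) f′≡w′ (lower D′ orD′ f′ modf′)

isDOMMaj-intro : ∀ {n} {G : Graph n} {w} D → IsOrientation G D → IsGammaMaj D w →
  (∀ D → IsOrientation G D → BoundedMODF D w) → IsDOMMaj G w
isDOMMaj-intro D orD γD upper =
  (D , orD , γD) ,
  λ D′ orD′ w′ (_ , minimal) →
    let (f , modf , f≤w) = upper D′ orD′ in ℤₚ.≤-trans (minimal f modf) f≤w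

-- dom⁺_maj

modf-onPath-plusCount : ∀ {n} (D : Digraph n) → OnPath D → ∀ f → IsMODF D f →
  n ≤ 2 * (plusCount f + pred (plusCount f))
modf-onPath-plusCount {n} D onPath f modf = begin
  n                         ≤⟨ modf⇒count D f (λ v → A (toℕ v) ∨ bothNeighbours A (toℕ v)) good modf ⟩
  2 * count {n} (λ v → A (toℕ v) ∨ bothNeighbours A (toℕ v))
                            ≤⟨ *-monoʳ-≤ 2 (count-∨ {n} (A ∘ toℕ) (bothNeighbours A ∘ toℕ)) ⟩
  2 * (a + count {n} (bothNeighbours A ∘ toℕ))
                            ≤⟨ *-monoʳ-≤ 2 (+-monoʳ-≤ a (count-bothNeighbours n A A-beyond)) ⟩
  2 * (a + pred a)          ≡⟨ cong (λ k → 2 * (k + pred k)) A-count ⟩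
  2 * (plusCount f + pred (plusCount f)) ∎
  where
  open ≤-Reasoning
  F = extend minus f
  A = isPlus ∘ F
  a = count {n} (A ∘ toℕ)
  A-beyond : A n ≡ false
  A-beyond = cong isPlus (extend-beyond minus f ≤-refl)
  good : ∀ u → IsGood D f u → T (A (toℕ u) ∨ bothNeighbours A (toℕ u))
  good u g = good⇒plus-or-flanked D onPath F u
    (subst (+ 1 ≤ℤ_) (closedOutSum-cong D (λ v → sym (extend-toℕ minus f v)) u) g)
  A-count : a ≡ plusCount f
  A-count = count-cong {n} (cong isPlus ∘ extend-toℕ minus f)

⌈/4⌉-upper : ∀ m → ⌈ m /4⌉ * 4 ≤ m + 3
⌈/4⌉-upper m = m/n*n≤m (m + 3) 4

⌈/4⌉-lower : ∀ m → m ≤ ⌈ m /4⌉ * 4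
⌈/4⌉-lower m = +-cancelˡ-≤ 3 m (⌈ m /4⌉ * 4) (begin
  3 + m                           ≡⟨ +-comm 3 m ⟩
  m + 3                           ≡⟨ m≡m%n+[m/n]*n (m + 3) 4 ⟩
  (m + 3) % 4 + ⌈ m /4⌉ * 4       ≤⟨ +-monoˡ-≤ _ (≤-pred (m%n<n (m + 3) 4)) ⟩
  3 + ⌈ m /4⌉ * 4                 ∎)
  where open ≤-Reasoning

⌈/4⌉-least : ∀ {m a} → m ≤ a * 4 → ⌈ m /4⌉ ≤ a
⌈/4⌉-least {m} {a} m≤4a = ≤-pred (m<n*o⇒m/o<n (begin-strict
  m + 3      ≤⟨ +-monoˡ-≤ 3 m≤4a ⟩
  a * 4 + 3  <⟨ +-monoʳ-< (a * 4) (n<1+n 3) ⟩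
  a * 4 + 4  ≡⟨ +-comm (a * 4) 4 ⟩
  suc a * 4  ∎))
  where open ≤-Reasoning

weight-lower-onPath : ∀ {n} (D : Digraph n) → OnPath D → 1 ≤ n → ∀ f → IsMODF D f →
  (2 * ⌈ n + 2 /4⌉) ⊖ n ≤ℤ weight f
weight-lower-onPath {n} D onPath 1≤n f modf =
  weight≥ f (c≤a (plusCount f) (modf-onPath-plusCount D onPath f modf))
  where
  c≤a : ∀ a → n ≤ 2 * (a + pred a) → ⌈ n + 2 /4⌉ ≤ a
  c≤a zero    n≤0 = contradiction (≤-trans 1≤n n≤0) λ ()
  c≤a (suc b) n≤  = ⌈/4⌉-least (begin
    n + 2               ≤⟨ +-monoˡ-≤ 2 n≤ ⟩
    2 * (suc b + b) + 2 ≡⟨ eq b ⟩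
    suc b * 4           ∎)
    where
    open ≤-Reasoning
    eq : ∀ b → 2 * (suc b + b) + 2 ≡ suc b * 4
    eq = solve-∀

oddToEven : (n : ℕ) → Digraph n
oddToEven n u v = odd (toℕ u) ∧ PathG n u v

odd-neighbour : ∀ {n} (u v : Fin n) → T (PathG n u v) → odd (toℕ v) ≡ not (odd (toℕ u))
odd-neighbour u v edge with pathNeighbour u v edge
... | inj₁ v≡1+u rewrite v≡1+u = even≡not-odd (toℕ u)
... | inj₂ 1+v≡u rewrite sym 1+v≡u | even≡not-odd (toℕ v) = sym (not-involutive (odd (toℕ v)))

oddToEven-orientation : ∀ n → IsOrientation (PathG n) (oddToEven n)
oddToEven-orientation n u v = arcOnEdge , oneDirection
  where
  arcOnEdge : oddToEven n u v ≡ true → PathG n u v ≡ true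
  arcOnEdge with odd (toℕ u)
  ... | true  = λ e → e
  ... | false = λ ()
  oneDirection : PathG n u v ≡ true → (oddToEven n u v xor oddToEven n v u) ≡ true
  oneDirection e = begin
    (odd (toℕ u) ∧ PathG n u v) xor (odd (toℕ v) ∧ PathG n v u)
      ≡⟨ cong₂ (λ p q → (odd (toℕ u) ∧ p) xor (odd (toℕ v) ∧ q)) e
               (trans (∨-comm (suc (toℕ v) ≡ᵇ toℕ u) (suc (toℕ u) ≡ᵇ toℕ v)) e) ⟩
    (odd (toℕ u) ∧ true) xor (odd (toℕ v) ∧ true)
      ≡⟨ cong₂ _xor_ (∧-identityʳ (odd (toℕ u)))
                     (trans (∧-identityʳ (odd (toℕ v))) (odd-neighbour u v (Equivalence.from T-≡ e))) ⟩
    odd (toℕ u) xor not (odd (toℕ u))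
      ≡⟨ xor-inverseʳ (odd (toℕ u)) ⟩
    true ∎
    where open ≡-Reasoning

evenBelow : ℕ → ℕ → PM
evenBelow p i = if (i <ᵇ p) ∧ even i then plus else minus

evenBelow-plus : ∀ {p i} → i < p → even i ≡ true → evenBelow p i ≡ plus
evenBelow-plus i<p even-i = if-plus (Equivalence.from T-∧ (<⇒<ᵇ i<p , Equivalence.from T-≡ even-i))

plusCount-evenBelow : ∀ {n} c → plusCount {n} (evenBelow (suc (c + c)) ∘ toℕ) ≤ suc c
plusCount-evenBelow {n} c = begin
  plusCount {n} (evenBelow p ∘ toℕ)
    ≡⟨ count-cong {n} (λ v → isPlus-if ((toℕ v <ᵇ p) ∧ even (toℕ v))) ⟩
  count {n} (λ v → (toℕ v <ᵇ p) ∧ even (toℕ v))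
    ≤⟨ count-<ᵇ-∧ {n} p even ⟩
  count {p} (even ∘ toℕ)
    ≡⟨ cong suc (count-odd c) ⟩
  suc c ∎
  where
  open ≤-Reasoning
  p = suc (c + c)

-- Below the odd bound p, the even vertices are positive sinks, and every odd vertex is a source
-- whose two out-neighbours are positive.
evenBelow-good : ∀ n c → suc (c + c) ≤ n → ∀ u → T (inInterval 0 (suc (c + c)) (toℕ u)) →
  IsGood (oddToEven n) (evenBelow (suc (c + c)) ∘ toℕ) u
evenBelow-good n c p≤n u inside = byParity (odd (toℕ u)) refl
  where
  p = suc (c + c)
  u<p : toℕ u < p
  u<p = proj₂ (inInterval⁻ {0} inside)
  byParity : ∀ b → odd (toℕ u) ≡ b → IsGood (oddToEven n) (evenBelow p ∘ toℕ) u
  byParity false parity = good-of-closed (oddToEven n) (evenBelow p ∘ toℕ) u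
    (evenBelow-plus u<p (trans (even≡not-odd (toℕ u)) (cong not parity)))
    (λ v arc → ⊥-elim (subst (λ b → T (b ∧ PathG n u v)) parity arc))
  byParity true parity = good-of-flanked (oddToEven n) (orientation⇒onPath (oddToEven-orientation n))
    (evenBelow p) u u≡1+j (<-≤-trans 1+u<p p≤n)
    (λ v edge → subst (λ b → T (b ∧ PathG n u v)) (sym parity) edge)
    (evenBelow-plus (<-trans (subst (pred (toℕ u) <_) (sym u≡1+j) (n<1+n _)) u<p)
                    (subst (λ i → odd i ≡ true) u≡1+j parity))
    (evenBelow-plus 1+u<p parity)
    where
    u≡1+j : toℕ u ≡ suc (pred (toℕ u))
    u≡1+j = odd⇒suc (toℕ u) parity
    1+u<p : suc (toℕ u) < p
    1+u<p = ≤∧≢⇒< u<p λ 1+u≡p → contradiction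
      (trans (sym (even-double c))
             (trans (cong odd (sym 1+u≡p)) (trans (even≡not-odd (toℕ u)) (cong not parity))))
      λ ()

evenBelow-boundedMODF : ∀ n c → suc (c + c) ≤ n → n ≤ 2 * suc (c + c) →
  BoundedMODF (oddToEven n) ((2 * suc c) ⊖ n)
evenBelow-boundedMODF n c p≤n n≤2p =
  evenBelow p ∘ toℕ ,
  modf-of-good (oddToEven n) (evenBelow p ∘ toℕ) (inInterval 0 p ∘ toℕ) (evenBelow-good n c p≤n)
    (subst (λ k → n ≤ 2 * k) (sym (count-inInterval 0 p p≤n)) n≤2p) ,
  weight≤ {n} (evenBelow p ∘ toℕ) (plusCount-evenBelow {n} c)
  where p = suc (c + c)

oddToEven-boundedMODF : ∀ n → 1 ≤ n → BoundedMODF (oddToEven n) ((2 * ⌈ n + 2 /4⌉) ⊖ n)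
oddToEven-boundedMODF n 1≤n with ⌈ n + 2 /4⌉ | ⌈/4⌉-lower (n + 2) | ⌈/4⌉-upper (n + 2)
... | zero  | n+2≤0 | _     = contradiction (≤-trans (m≤n+m 2 n) n+2≤0) λ ()
... | suc c | lower | upper = evenBelow-boundedMODF n c (p≤n c upper) n≤2p
  where
  n≤2p : n ≤ 2 * suc (c + c)
  n≤2p = +-cancelʳ-≤ 2 n _ (subst (n + 2 ≤_) (eq₁ c) lower)
    where
    eq₁ : ∀ c → suc c * 4 ≡ 2 * suc (c + c) + 2
    eq₁ = solve-∀
  p≤n : ∀ c → suc c * 4 ≤ n + 2 + 3 → suc (c + c) ≤ n
  p≤n zero    _  = 1≤n
  p≤n (suc d) le = begin
    suc (suc d + suc d) ≡⟨ eq₂ d ⟩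
    2 * d + 3           ≤⟨ +-monoˡ-≤ 3 (*-monoˡ-≤ d {2} {4} (s≤s (s≤s z≤n))) ⟩
    4 * d + 3           ≤⟨ +-cancelʳ-≤ 5 _ n (subst₂ _≤_ (eq₃ d) (+-assoc n 2 3) le) ⟩
    n                   ∎
    where
    open ≤-Reasoning
    eq₂ : ∀ d → suc (suc d + suc d) ≡ 2 * d + 3
    eq₂ = solve-∀
    eq₃ : ∀ d → suc (suc d) * 4 ≡ 4 * d + 3 + 5
    eq₃ = solve-∀

isDomMaj-path : ∀ n → 1 ≤ n → IsDomMaj (PathG n) ((2 * ⌈ n + 2 /4⌉) ⊖ n)
isDomMaj-path n 1≤n =
  isDomMaj-intro (oddToEven n) (oddToEven-orientation n) (oddToEven-boundedMODF n 1≤n)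
                 (λ D orD → weight-lower-onPath D (orientation⇒onPath orD) 1≤n)

-- DOM⁺_maj

2*m≡m+m : ∀ m → 2 * m ≡ m + m
2*m≡m+m m = cong₂ _+_ (refl {x = m}) (+-identityʳ m)

2*[1+m]≡2+[m+m] : ∀ m → 2 * suc m ≡ suc (suc (m + m))
2*[1+m]≡2+[m+m] = solve-∀

1+[m+m]≤2*[1+m] : ∀ m → suc (m + m) ≤ 2 * suc m
1+[m+m]≤2*[1+m] m = ≤-trans (n≤1+n _) (≤-reflexive (sym (2*[1+m]≡2+[m+m] m)))

directedPath : (n : ℕ) → Digraph n
directedPath n u v = suc (toℕ u) ≡ᵇ toℕ v

directedPath-orientation : ∀ n → IsOrientation (PathG n) (directedPath n)
directedPath-orientation n u v =
  cong (_∨ (suc (toℕ v) ≡ᵇ toℕ u)) ,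
  xor-of-∨ (suc (toℕ u) ≡ᵇ toℕ v) (suc (toℕ v) ≡ᵇ toℕ u) (pathEdges-disjoint (toℕ u) (toℕ v))
  where
  xor-of-∨ : ∀ a b → (a ∧ b) ≡ false → (a ∨ b) ≡ true → (a xor b) ≡ true
  xor-of-∨ true  false _ _ = refl
  xor-of-∨ false true  _ _ = refl

directedPath-good⇒plus : ∀ n (f : Fin n → PM) u → IsGood (directedPath n) f u → T (isPlus (f u))
directedPath-good⇒plus n f u good with f u | ℤₚ.≤-trans good (ℤₚ.+-monoʳ-≤ (val (f u)) outSum≤1)
  where
  term : ∀ b x → (if b then val x else + 0) ≤ℤ (if b then + 1 else + 0)
  term true  plus  = ℤₚ.≤-refl
  term true  minus = -≤+
  term false _     = ℤₚ.≤-refl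
  outSum≤1 : Σℤ (λ v → if directedPath n u v then val (f v) else + 0) ≤ℤ + 1
  outSum≤1 = ℤₚ.≤-trans (Σℤ-mono (λ v → term (directedPath n u v) (f v)))
    (subst (_≤ℤ + 1) (sym (Σℤ-successor n (toℕ u) (λ _ → + 1)))
           (if-≤ (suc (toℕ u) <ᵇ n) (+≤+ z≤n)))
... | plus  | _         = _
... | minus | +≤+ ()

directedPath-noArcDown : ∀ n l → NoArcDown (directedPath n) l
directedPath-noArcDown n l u v arc u≡l 1+v≡l = <-irrefl (sym loop) (<-trans (n<1+n _) (n<1+n _))
  where
  loop : suc (suc (toℕ u)) ≡ toℕ u
  loop = trans (cong suc (≡ᵇ⇒≡ (suc (toℕ u)) (toℕ v) arc)) (trans 1+v≡l (sym u≡l))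

-- In the directed path only positive vertices are good, so its γ⁺ is the least 2h − n with
-- n ≤ 2h, attained by a positive suffix.
isDOMMaj-path : ∀ n h → h ≤ n → n ≤ 2 * h → (∀ a → n ≤ 2 * a → h ≤ a) →
  (∀ D → IsOrientation (PathG n) D → BoundedMODF D ((2 * h) ⊖ n)) → IsDOMMaj (PathG n) ((2 * h) ⊖ n)
isDOMMaj-path n h h≤n n≤2h least upper =
  isDOMMaj-intro D (directedPath-orientation n) (isGammaMaj-intro suffix lower) upper
  where
  D = directedPath n
  suffix : BoundedMODF D ((2 * h) ⊖ n)
  suffix = subst (λ k → BoundedMODF D ((2 * k) ⊖ n)) (m∸[m∸n]≡n h≤n)
    (block-boundedMODF D (orientation⇒onPath (directedPath-orientation n)) ≤-refl
      (subst (λ k → n ≤ 2 * k) (sym (m∸[m∸n]≡n h≤n)) n≤2h)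
      (noArcUp-end D) (directedPath-noArcDown n (n ∸ h)))
  lower : ∀ f → IsMODF D f → (2 * h) ⊖ n ≤ℤ weight f
  lower f modf =
    weight≥ f (least (plusCount f) (modf⇒count D f (isPlus ∘ f) (directedPath-good⇒plus n f) modf))

-- Split the path P_{2k} in the middle: the half not entered through the middle edge is closed.
evenPath-boundedMODF : ∀ k (D : Digraph (suc k + suc k)) → IsOrientation (PathG (suc k + suc k)) D →
  BoundedMODF D ((2 * suc k) ⊖ (suc k + suc k))
evenPath-boundedMODF k D or = byMiddleArc (T? (D x y))
  where
  n = suc k + suc k
  onPath = orientation⇒onPath or
  k<n : k < n
  k<n = m≤m+n (suc k) (suc k)
  1+k<n : suc k < n
  1+k<n = m<m+n (suc k) (s≤s z≤n)
  x y : Fin n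
  x = fromℕ< k<n
  y = fromℕ< 1+k<n
  y≡1+k : toℕ y ≡ suc k
  y≡1+k = toℕ-fromℕ< 1+k<n
  y≡1+x : toℕ y ≡ suc (toℕ x)
  y≡1+x = trans y≡1+k (cong suc (sym (toℕ-fromℕ< k<n)))
  n≤2h : n ≤ 2 * suc k
  n≤2h = ≤-reflexive (sym (2*m≡m+m (suc k)))
  byMiddleArc : Dec (T (D x y)) → BoundedMODF D ((2 * suc k) ⊖ n)
  byMiddleArc (no ¬xy) = subst (λ h → BoundedMODF D ((2 * h) ⊖ n)) y≡1+k
    (prefix-boundedMODF D onPath {x} {y} ¬xy y≡1+x (subst (λ h → n ≤ 2 * h) (sym y≡1+k) n≤2h))
  byMiddleArc (yes xy) = subst (λ h → BoundedMODF D ((2 * h) ⊖ n)) half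
    (suffix-boundedMODF D onPath {x} {y} (orientation-antisym or (proj₁ (path-edge {x = x} {y} y≡1+x)) xy)
      y≡1+x (subst (λ h → n ≤ 2 * h) (sym half) n≤2h))
    where
    half : n ∸ toℕ y ≡ suc k
    half = trans (cong (n ∸_) y≡1+k) (m+n∸n≡m (suc k) (suc k))

gapBlock : ℕ → ℕ → PM
gapBlock m i = if inInterval 0 m i ∨ inInterval (suc m) (suc (suc m)) i then plus else minus

plusCount-gapBlock : ∀ {n} m → suc m < n → plusCount {n} (gapBlock m ∘ toℕ) ≤ suc m
plusCount-gapBlock {n} m 2+m≤n = begin
  plusCount {n} (gapBlock m ∘ toℕ)
    ≡⟨ count-cong {n} (λ v → isPlus-if (inInterval 0 m (toℕ v) ∨ inInterval (suc m) (suc (suc m)) (toℕ v))) ⟩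
  count {n} (λ v → inInterval 0 m (toℕ v) ∨ inInterval (suc m) (suc (suc m)) (toℕ v))
    ≤⟨ count-∨ {n} (inInterval 0 m ∘ toℕ) (inInterval (suc m) (suc (suc m)) ∘ toℕ) ⟩
  count {n} (inInterval 0 m ∘ toℕ) + count {n} (inInterval (suc m) (suc (suc m)) ∘ toℕ)
    ≡⟨ cong₂ _+_ (count-inInterval 0 m (≤-trans (n≤1+n m) (≤-trans (n≤1+n (suc m)) 2+m≤n)))
                 (count-inInterval (suc m) (suc (suc m)) 2+m≤n) ⟩
  m + (suc (suc m) ∸ suc m)
    ≡⟨ cong₂ _+_ (refl {x = m}) (m+n∸n≡m 1 (suc m)) ⟩
  m + 1
    ≡⟨ +-comm m 1 ⟩
  suc m ∎
  where open ≤-Reasoning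

-- No arc leaves [0, m) because m → m − 1, and the source m has both of its out-neighbours positive.
source-boundedMODF : ∀ {n} (D : Digraph n) → IsOrientation (PathG n) D → ∀ {x y z} →
  toℕ x ≡ suc (toℕ z) → toℕ y ≡ suc (toℕ x) → T (D x y) → T (D x z) → n ≤ 2 * suc (toℕ x) →
  BoundedMODF D ((2 * suc (toℕ x)) ⊖ n)
source-boundedMODF {n} D or {x} {y} {z} x≡1+z y≡1+x xy xz n≤ =
  gapBlock m ∘ toℕ ,
  modf-of-good D (gapBlock m ∘ toℕ) (inInterval 0 (suc m) ∘ toℕ) good
    (subst (λ k → n ≤ 2 * k) (sym (count-inInterval 0 (suc m) (<⇒≤ 1+m<n))) n≤) ,
  weight≤ {n} (gapBlock m ∘ toℕ) (plusCount-gapBlock m 1+m<n)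
  where
  m = toℕ x
  onPath = orientation⇒onPath or
  1+m<n : suc m < n
  1+m<n = subst (_< n) y≡1+x (toℕ<n y)
  ¬zx : ¬ T (D z x)
  ¬zx = orientation-antisym or (proj₂ (path-edge {x = z} {x} x≡1+z)) xz
  allArcs : ∀ v → T (PathG n x v) → T (D x v)
  allArcs v edge with pathNeighbour x v edge
  ... | inj₁ v≡1+x with toℕ-injective {i = v} {y} (trans v≡1+x (sym y≡1+x))
  ...   | refl = xy
  allArcs v edge | inj₂ 1+v≡x with toℕ-injective {i = v} {z} (suc-injective (trans 1+v≡x x≡1+z))
  ...   | refl = xz
  good : ∀ u → T (inInterval 0 (suc m) (toℕ u)) → IsGood D (gapBlock m ∘ toℕ) u
  good u inside with toℕ u <? m
  ... | yes u<m = good-in-interval D onPath (gapBlock m) (λ _ i∈ → if-plus (Equivalence.from T-∨ (inj₁ i∈)))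
                    (noArcUp-of-absent D {z} {x} ¬zx x≡1+z) (noArcDown-start D) u (inInterval⁺ z≤n u<m)
  ... | no u≮m with toℕ-injective {i = u} {x} (≤-antisym (≤-pred (proj₂ (inInterval⁻ {0} inside))) (≮⇒≥ u≮m))
  ...   | refl = good-of-flanked D onPath (gapBlock m) x x≡1+z 1+m<n allArcs
    (if-plus (Equivalence.from T-∨ (inj₁ (inInterval⁺ z≤n (subst (toℕ z <_) (sym x≡1+z) ≤-refl)))))
    (if-plus (Equivalence.from (T-∨ {inInterval 0 m (suc m)}) (inj₂ (inInterval⁺ {suc m} ≤-refl ≤-refl))))

-- In P_{2m+1} the middle vertex m is entered from m + 1 (take the prefix up to m), or from m − 1
-- (take the suffix from m), or is a source (positive prefix [0, m) together with m + 1).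
oddPath-boundedMODF : ∀ m (D : Digraph (suc (m + m))) → IsOrientation (PathG (suc (m + m))) D →
  BoundedMODF D ((2 * suc m) ⊖ suc (m + m))
oddPath-boundedMODF zero    D or =
  block-boundedMODF D (orientation⇒onPath or) {0} {1} ≤-refl (s≤s z≤n) (noArcUp-end D) (noArcDown-start D)
oddPath-boundedMODF (suc j) D or = byArcs (T? (D x y)) (T? (D x z))
  where
  m = suc j
  n = suc (m + m)
  onPath = orientation⇒onPath or
  j<n : j < n
  j<n = s≤s (≤-trans (n≤1+n j) (m≤m+n m m))
  m<n : m < n
  m<n = s≤s (m≤m+n m m)
  1+m<n : suc m < n
  1+m<n = s≤s (m<m+n m (s≤s z≤n))
  x y z : Fin n
  x = fromℕ< m<n
  y = fromℕ< 1+m<n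
  z = fromℕ< j<n
  x≡m : toℕ x ≡ m
  x≡m = toℕ-fromℕ< m<n
  x≡1+z : toℕ x ≡ suc (toℕ z)
  x≡1+z = trans x≡m (cong suc (sym (toℕ-fromℕ< j<n)))
  y≡1+x : toℕ y ≡ suc (toℕ x)
  y≡1+x = trans (toℕ-fromℕ< 1+m<n) (cong suc (sym x≡m))
  n≤2h : n ≤ 2 * suc m
  n≤2h = 1+[m+m]≤2*[1+m] m
  weightAt : ∀ {k} → k ≡ suc m → BoundedMODF D ((2 * k) ⊖ n) → BoundedMODF D ((2 * suc m) ⊖ n)
  weightAt k≡1+m = subst (λ k → BoundedMODF D ((2 * k) ⊖ n)) k≡1+m
  atLeast : ∀ {k} → k ≡ suc m → n ≤ 2 * k
  atLeast k≡1+m = subst (λ k → n ≤ 2 * k) (sym k≡1+m) n≤2h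
  byArcs : Dec (T (D x y)) → Dec (T (D x z)) → BoundedMODF D ((2 * suc m) ⊖ n)
  byArcs (no ¬xy) _ = weightAt (toℕ-fromℕ< 1+m<n)
    (prefix-boundedMODF D onPath {x} {y} ¬xy y≡1+x (atLeast (toℕ-fromℕ< 1+m<n)))
  byArcs (yes _) (no ¬xz) = weightAt n∸m
    (suffix-boundedMODF D onPath {z} {x} ¬xz x≡1+z (atLeast n∸m))
    where
    n∸m : n ∸ toℕ x ≡ suc m
    n∸m = trans (cong (n ∸_) x≡m) (m+n∸n≡m (suc m) m)
  byArcs (yes xy) (yes xz) = weightAt (cong suc x≡m)
    (source-boundedMODF D or {x} {y} {z} x≡1+z y≡1+x xy xz (atLeast (cong suc x≡m)))

isDOMMaj-evenPath : ∀ k → IsDOMMaj (PathG (suc k + suc k)) (+ 0)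
isDOMMaj-evenPath k = subst (IsDOMMaj (PathG n)) (trans (cong (_⊖ n) 2h≡n) (ℤₚ.n⊖n≡0 n))
  (isDOMMaj-path n h (m≤m+n h h) (≤-reflexive (sym 2h≡n)) least (evenPath-boundedMODF k))
  where
  h = suc k
  n = h + h
  2h≡n : 2 * h ≡ n
  2h≡n = 2*m≡m+m h
  least : ∀ a → n ≤ 2 * a → h ≤ a
  least a n≤2a = *-cancelˡ-≤ 2 (subst (_≤ 2 * a) (sym 2h≡n) n≤2a)

isDOMMaj-oddPath : ∀ m → IsDOMMaj (PathG (suc (m + m))) (+ 1)
isDOMMaj-oddPath m = subst (IsDOMMaj (PathG n)) weight≡1
  (isDOMMaj-path n (suc m) (s≤s (m≤m+n m m)) (1+[m+m]≤2*[1+m] m) least (oddPath-boundedMODF m))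
  where
  n = suc (m + m)
  weight≡1 : (2 * suc m) ⊖ n ≡ + 1
  weight≡1 = trans (cong (_⊖ n) (2*[1+m]≡2+[m+m] m)) (trans (ℤₚ.⊖-≥ (n≤1+n n)) (cong +_ (m+n∸n≡m 1 n)))
  least : ∀ a → n ≤ 2 * a → suc m ≤ a
  least a n≤2a = ≰⇒> λ a≤m → <-irrefl refl (begin-strict
    m + m      <⟨ n≤2a ⟩
    2 * a      ≤⟨ *-monoʳ-≤ 2 a≤m ⟩
    2 * m      ≡⟨ 2*m≡m+m m ⟩
    m + m      ∎)
    where open ≤-Reasoning

n≡n%2+[n/2+n/2] : ∀ n → n ≡ n % 2 + (n / 2 + n / 2)
n≡n%2+[n/2+n/2] n =
  trans (m≡m%n+[m/n]*n n 2) (cong₂ _+_ (refl {x = n % 2}) (trans (*-comm (n / 2) 2) (2*m≡m+m (n / 2))))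

proposition4p2 : (n : ℕ) → n ≥ 1 →
    IsDomMaj (PathG n) (- (+ n) +ℤ (+ 2) *ℤ (+ ⌈ n + 2 /4⌉))
    × (n % 2 ≡ 0 → IsDOMMaj (PathG n) (+ 0))
    × (n % 2 ≡ 1 → IsDOMMaj (PathG n) (+ 1))
proposition4p2 n 1≤n =
  subst (IsDomMaj (PathG n)) (sym formula) (isDomMaj-path n 1≤n) ,
  evenCase ,
  oddCase
  where
  formula : - (+ n) +ℤ (+ 2) *ℤ (+ ⌈ n + 2 /4⌉) ≡ (2 * ⌈ n + 2 /4⌉) ⊖ n
  formula = trans (cong (- (+ n) +ℤ_) (sym (ℤₚ.pos-* 2 ⌈ n + 2 /4⌉)))
                  (ℤₚ.-m+n≡n⊖m n (2 * ⌈ n + 2 /4⌉))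
  evenCase : n % 2 ≡ 0 → IsDOMMaj (PathG n) (+ 0)
  evenCase r≡0 with n / 2 | n≡n%2+[n/2+n/2] n
  ... | zero  | n≡ = contradiction (subst (1 ≤_) (trans n≡ (cong (_+ 0) r≡0)) 1≤n) λ ()
  ... | suc k | n≡ = subst (λ n → IsDOMMaj (PathG n) (+ 0)) (sym (trans n≡ (cong (_+ (suc k + suc k)) r≡0)))
                       (isDOMMaj-evenPath k)
  oddCase : n % 2 ≡ 1 → IsDOMMaj (PathG n) (+ 1)
  oddCase r≡1 = subst (λ n → IsDOMMaj (PathG n) (+ 1)) (sym n≡) (isDOMMaj-oddPath (n / 2))
    where
    n≡ : n ≡ suc (n / 2 + n / 2)
    n≡ = trans (n≡n%2+[n/2+n/2] n) (cong (_+ (n / 2 + n / 2)) r≡1)
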